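{- Let $\mathbf{m}=(m_1,m_2,\dots,m_P)$ be a tuple of non-negative integers with $\sum_i m_i=n$. Then $$\mathrm{F}_{\mathbf{m}}(x_1,\dots,x_n;s)=\Big(\prod_{i=1}^n x_i^{ -1}\Big)\,\mathcal{F}_{\mathbf{m}}(x_1^{ -1},\dots,x_n^{ -1};s).$$
   Context: $q,s$ are parameters. $\mathrm{F}_{\mathbf{m}}$: consider a grid with $P$ rows (indexed $1,\dots,P$ top to bottom) and $n$ columns with variables $x_1,\dots,x_n$ (left to right). Vertical edges carry labels in $\{0,1\}$, horizontal edges non-negative integers. Boundary: left edge of row $i$ is $m_i$, right boundary edges $0$, bottom boundary edges $0$, top boundary edges $1$. For a vertex in a column with variable $x$, with labels $(a,b,c,d)$ on (bottom, left, top, right), the nonzero weights are: $(1,m,1,m)\mapsto\frac{1-q^mxs}{x-s}$; $(0,m,1,m-1)\mapsto\frac{1-q^m}{x-s}$; $(1,m,0,m+1)\mapsto\frac{(1-q^ms^2)x}{x-s}$; $(0,m,0,m)\mapsto\frac{x-q^ms}{x-s}$; others are $0$. $\mathrm{F}_{\mathbf{m}}(x_1,\dots,x_n;s)$ is the sum over labellings of products of vertex weights. $\mathcal{F}_{\mathbf{m}}$ (Borodin's spin Hall–Littlewood function): consider a grid with $n$ rows with variables $x_1,\dots,x_n$ (top to bottom) and $P$ columns (indexed $1,\dots,P$ left to right). Vertical edges carry non-negative integers, horizontal edges labels in $\{0,1\}$. Boundary: top edge of column $j$ is $m_j$, bottom boundary edges $0$, left boundary edges $1$, right boundary edges $0$.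 For a vertex in a row with variable $x$, with labels $(A,B,C,D)$ on (bottom, left, top, right), the nonzero weights are: $(m,0,m,0)\mapsto\frac{1-sxq^m}{1-sx}$; $(m+1,0,m,1)\mapsto\frac{(1-s^2q^m)x}{1-sx}$; $(m,1,m+1,0)\mapsto\frac{1-q^{m+1}}{1-sx}$; $(m,1,m,1)\mapsto\frac{x-sq^m}{1-sx}$; others are $0$. $\mathcal{F}_{\mathbf{m}}(x_1,\dots,x_n;s)$ is the sum over labellings of products of vertex weights. -}

module Defs where

open import Algebra.Bundles using (CommutativeRing)
open import Data.Nat using (ℕ; zero; suc; _≡ᵇ_)
open import Data.Bool using (Bool; true; false; if_then_else_)
open import Data.List using (List; []; _∷_; map; foldr; upTo)
open import Data.Vec using (Vec; []; _∷_; replicate; toList)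

module SixVertex {c ℓ} (R : CommutativeRing c ℓ) where
  open CommutativeRing R

  pow : Carrier → ℕ → Carrier
  pow q zero = 1#
  pow q (suc k) = q * pow q k

  sumL : List Carrier → Carrier
  sumL = foldr _+_ 0#

  prodV : ∀ {k} → Vec Carrier k → Carrier
  prodV [] = 1#
  prodV (x ∷ xs) = x * prodV xs

  allZero : ∀ {k} → Vec ℕ k → Carrier
  allZero [] = 1#
  allZero (zero ∷ v) = allZero v
  allZero (suc _ ∷ v) = 0#

  -- Weights of F_m.  Labels (bottom a, left b, top c, right d).
  -- x is the column variable, i is an inverse of (x - s).
  wF : (q s x i : Carrier) → ℕ → ℕ → ℕ → ℕ → Carrier
  wF q s x i 1 b 1 d = if b ≡ᵇ d then (1# - pow q b * x * s) * i else 0#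
  wF q s x i 0 b 1 d = if b ≡ᵇ suc d then (1# - pow q b) * i else 0#
  wF q s x i 1 b 0 d = if suc b ≡ᵇ d then (1# - pow q b * s * s) * x * i else 0#
  wF q s x i 0 b 0 d = if b ≡ᵇ d then (x - pow q b * s) * i else 0#
  wF q s x i _ _ _ _ = 0#

  -- one row of F_m: left label b, variables xs with inverses is of (x - s),
  -- top labels cs; the continuation k receives the bottom labels.
  -- Bottom (vertical) labels range over {0,1}; the right horizontal label
  -- ranges over 0..b+1 (all other values give weight 0).
  rowF : ∀ {k} (q s : Carrier) → Vec Carrier k → Vec Carrier k → ℕ → Vec ℕ k
       → (Vec ℕ k → Carrier) → Carrier
  rowF q s [] [] b [] k = if b ≡ᵇ 0 then k [] else 0#
  rowF q s (x ∷ xs) (i ∷ is) b (c ∷ cs) k =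
    sumL (map (λ a → sumL (map (λ d → wF q s x i a b c d
                                 * rowF q s xs is d cs (λ as → k (a ∷ as)))
                               (upTo (suc (suc b)))))
              (0 ∷ 1 ∷ []))

  gridF : ∀ {k} (q s : Carrier) → Vec Carrier k → Vec Carrier k → List ℕ
        → Vec ℕ k → Carrier
  gridF q s xs is [] tops = allZero tops
  gridF q s xs is (mi ∷ ms) tops = rowF q s xs is mi tops (gridF q s xs is ms)

  Fm : ∀ {P n} (q s : Carrier) → Vec ℕ P → Vec Carrier n → Vec Carrier n → Carrier
  Fm {n = n} q s m xs is = gridF q s xs is (toList m) (replicate n 1)

  -- Weights of Borodin's spin Hall–Littlewood 𝓕_m.  Labels (bottom A, left B, top C, right D).
  -- y is the row variable, e an inverse of (1 - s y).
  wC : (q s y e : Carrier) → ℕ → ℕ → ℕ → ℕ → Carrier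
  wC q s y e A 0 C 0 = if A ≡ᵇ C then (1# - s * y * pow q C) * e else 0#
  wC q s y e A 0 C 1 = if A ≡ᵇ suc C then (1# - s * s * pow q C) * y * e else 0#
  wC q s y e A 1 C 0 = if C ≡ᵇ suc A then (1# - pow q C) * e else 0#
  wC q s y e A 1 C 1 = if A ≡ᵇ C then (y - s * pow q C) * e else 0#
  wC q s y e _ _ _ _ = 0#

  -- one row: left label B, top labels Cs; continuation receives bottom labels.
  -- Right (horizontal) labels range over {0,1}; bottom labels over 0..C+1
  -- (all other values give weight 0).
  rowC : ∀ {p} (q s y e : Carrier) → ℕ → Vec ℕ p → (Vec ℕ p → Carrier) → Carrier
  rowC q s y e B [] k = if B ≡ᵇ 0 then k [] else 0#
  rowC q s y e B (C ∷ Cs) k =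
    sumL (map (λ A → sumL (map (λ D → wC q s y e A B C D
                                 * rowC q s y e D Cs (λ As → k (A ∷ As)))
                               (0 ∷ 1 ∷ [])))
              (upTo (suc (suc C))))

  gridC : ∀ {p n} (q s : Carrier) → Vec Carrier n → Vec Carrier n → Vec ℕ p → Carrier
  gridC q s [] [] tops = allZero tops
  gridC q s (y ∷ ys) (e ∷ es) tops = rowC q s y e 1 tops (gridC q s ys es)

  Fcal : ∀ {P n} (q s : Carrier) → Vec ℕ P → Vec Carrier n → Vec Carrier n → Carrier
  Fcal q s m ys es = gridC q s ys es m

{-# OPTIONS --safe #-}
-- Transposing the lattice of F_m turns its j-th column (variable x_j) into the j-th row of 𝓕_m
-- (variable y_j = x_j⁻¹), a vertex with labels (a, b, c, d) becoming one with labels (d, c, b, a).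
-- Since 1 / (1 - s y) = x / (x - s), the weights then agree up to a gauge factor,
-- w_F(a, b, c, d) y^a = y^c w_𝓕(d, c, b, a), and along a column these factors telescope from the
-- top label 1 to the bottom label 0, leaving one factor y_j per column.  Both partition functions
-- are evaluated row by row, so to peel the first column off F one exchanges the finite sums of a
-- row of F with those of a row of 𝓕; this is legitimate because every row sum is linear in the
-- rest of the configuration.
module Submission where

open import Defs
open import Level using (Level; _⊔_)
open import Algebra.Bundles using (CommutativeRing)
open import Data.Bool using (true; false; if_then_else_)
import Data.Fin as Fin
open import Data.List using (List; []; _∷_; map; upTo)
open import Data.Nat using (ℕ; zero; suc; _≡ᵇ_)
open import Data.Vec using (Vec; []; _∷_; lookup; sum; toList; replicate)
open import Function using (_∘_)
open import Relation.Binary.PropositionalEquality using (_≡_) renaming (refl to ≡-refl)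

≡ᵇ-comm : ∀ m n → (m ≡ᵇ n) ≡ (n ≡ᵇ m)
≡ᵇ-comm zero    zero    = ≡-refl
≡ᵇ-comm zero    (suc n) = ≡-refl
≡ᵇ-comm (suc m) zero    = ≡-refl
≡ᵇ-comm (suc m) (suc n) = ≡ᵇ-comm m n

module Transposition {c ℓ} (R : CommutativeRing c ℓ) where
  open CommutativeRing R
  open SixVertex R
  open import Relation.Binary.Reasoning.Setoid setoid
  open import Algebra.Solver.Ring.NaturalCoefficients.Default commutativeSemiring
  open import Algebra.Properties.Ring ring using (x[y-z]≈xy-xz; [y-z]x≈yx-zx)
  open import Algebra.Properties.CommutativeSemigroup +-commutativeSemigroup using (interchange)
  open import Algebra.Properties.Group +-group using (//-cong₂)

  ∑ : {B : Set} → List B → (B → Carrier) → Carrier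
  ∑ L f = sumL (map f L)

  record Linear {A : Set} (Λ : (A → Carrier) → Carrier) : Set (c ⊔ ℓ) where
    field
      cong   : ∀ {f g} → (∀ a → f a ≈ g a) → Λ f ≈ Λ g
      +-homo : ∀ f g → Λ (λ a → f a + g a) ≈ Λ f + Λ g
      *-homo : ∀ t f → Λ (λ a → t * f a) ≈ t * Λ f

    0-homo : Λ (λ _ → 0#) ≈ 0#
    0-homo = begin
      Λ (λ _ → 0#)       ≈⟨ cong (λ _ → sym (zeroˡ 0#)) ⟩
      Λ (λ _ → 0# * 0#)  ≈⟨ *-homo 0# (λ _ → 0#) ⟩
      0# * Λ (λ _ → 0#)  ≈⟨ zeroˡ _ ⟩
      0#                 ∎

    ∑-homo : {B : Set} (L : List B) (f : B → A → Carrier) →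
             Λ (λ a → ∑ L (λ b → f b a)) ≈ ∑ L (λ b → Λ (f b))
    ∑-homo []      f = 0-homo
    ∑-homo (b ∷ L) f = trans (+-homo (f b) _) (+-congˡ (∑-homo L f))

  ∑-cong : {B : Set} (L : List B) {f g : B → Carrier} → (∀ b → f b ≈ g b) → ∑ L f ≈ ∑ L g
  ∑-cong []      f≈g = refl
  ∑-cong (b ∷ L) f≈g = +-cong (f≈g b) (∑-cong L f≈g)

  ∑-linear : {B : Set} (L : List B) → Linear (∑ L)
  ∑-linear L = record { cong = ∑-cong L ; +-homo = +-homoᴸ L ; *-homo = *-homoᴸ L }
    where
    +-homoᴸ : ∀ L f g → ∑ L (λ b → f b + g b) ≈ ∑ L f + ∑ L g
    +-homoᴸ []      f g = sym (+-identityˡ 0#)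
    +-homoᴸ (b ∷ L) f g = trans (+-congˡ (+-homoᴸ L f g)) (interchange _ _ _ _)

    *-homoᴸ : ∀ L t f → ∑ L (λ b → t * f b) ≈ t * ∑ L f
    *-homoᴸ []      t f = sym (zeroʳ t)
    *-homoᴸ (b ∷ L) t f = trans (+-congˡ (*-homoᴸ L t f)) (sym (distribˡ t _ _))

  evaluation-linear : {A : Set} (a : A) → Linear (λ f → f a)
  evaluation-linear a = record
    { cong = λ f≈g → f≈g a ; +-homo = λ _ _ → refl ; *-homo = λ _ _ → refl }

  zero-linear : {A : Set} → Linear {A} (λ _ → 0#)
  zero-linear = record
    { cong = λ _ → refl ; +-homo = λ _ _ → sym (+-identityˡ 0#) ; *-homo = λ t _ → sym (zeroʳ t) }

  precompose-linear : {A B : Set} {Λ : (A → Carrier) → Carrier} (h : A → B) →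
                      Linear Λ → Linear (λ f → Λ (f ∘ h))
  precompose-linear h lin = record
    { cong = λ f≈g → cong (f≈g ∘ h) ; +-homo = λ f g → +-homo (f ∘ h) (g ∘ h)
    ; *-homo = λ t f → *-homo t (f ∘ h) }
    where open Linear lin

  scale-linear : {A : Set} {Λ : (A → Carrier) → Carrier} (w : Carrier) →
                 Linear Λ → Linear (λ f → w * Λ f)
  scale-linear w lin = record
    { cong   = λ f≈g → *-congˡ (cong f≈g)
    ; +-homo = λ f g → trans (*-congˡ (+-homo f g)) (distribˡ w _ _)
    ; *-homo = λ t f → trans (*-congˡ (*-homo t f)) (x∙yz≈y∙xz w t _) }
    where
    open Linear lin
    open import Algebra.Properties.CommutativeSemigroup *-commutativeSemigroup using (x∙yz≈y∙xz)

  mixture-linear : {A B : Set} {Λ : (B → Carrier) → Carrier} {M : B → (A → Carrier) → Carrier} →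
                   Linear Λ → (∀ b → Linear (M b)) → Linear (λ f → Λ (λ b → M b f))
  mixture-linear lin linM = record
    { cong   = λ f≈g → Λ.cong (λ b → M.cong b f≈g)
    ; +-homo = λ f g → trans (Λ.cong (λ b → M.+-homo b f g)) (Λ.+-homo _ _)
    ; *-homo = λ t f → trans (Λ.cong (λ b → M.*-homo b t f)) (Λ.*-homo t _) }
    where
    module Λ = Linear lin
    module M b = Linear (linM b)

  inverse-unique : ∀ {u v w} → u * v ≈ 1# → u * w ≈ 1# → v ≈ w
  inverse-unique {u} {v} {w} uv≈1 uw≈1 = begin
    v            ≈⟨ sym (*-identityˡ v) ⟩
    1# * v       ≈⟨ *-congʳ (sym uw≈1) ⟩
    u * w * v    ≈⟨ solve 3 (λ u v w → u :* w :* v := u :* v :* w) refl u v w ⟩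
    u * v * w    ≈⟨ *-congʳ uv≈1 ⟩
    1# * w       ≈⟨ *-identityˡ w ⟩
    w            ∎

  inverse-1-sy : ∀ s {x y i e} → x * y ≈ 1# → (x - s) * i ≈ 1# → (1# - s * y) * e ≈ 1# →
                 e ≈ x * i
  inverse-1-sy s {x} {y} {i} {e} xy≈1 [x-s]i≈1 [1-sy]e≈1 =
    inverse-unique [1-sy]e≈1 (begin
      (1# - s * y) * (x * i)    ≈⟨ solve 3 (λ t x i → t :* (x :* i) := x :* t :* i) refl _ x i ⟩
      x * (1# - s * y) * i      ≈⟨ *-congʳ x[1-sy]≈x-s ⟩
      (x - s) * i               ≈⟨ [x-s]i≈1 ⟩
      1#                        ∎)
    where
    x[1-sy]≈x-s : x * (1# - s * y) ≈ x - s
    x[1-sy]≈x-s = begin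
      x * (1# - s * y)        ≈⟨ x[y-z]≈xy-xz x 1# (s * y) ⟩
      x * 1# - x * (s * y)    ≈⟨ //-cong₂ (*-identityʳ x)
                                   (solve 3 (λ x s y → x :* (s :* y) := s :* (x :* y)) refl x s y) ⟩
      x - s * (x * y)         ≈⟨ //-cong₂ refl (trans (*-congˡ xy≈1) (*-identityʳ s)) ⟩
      x - s                   ∎

  module Lattice (q s : Carrier) where

    rowF-linear : ∀ {k} (xs is : Vec Carrier k) b (cs : Vec ℕ k) → Linear (rowF q s xs is b cs)
    rowF-linear []       []       zero    [] = evaluation-linear []
    rowF-linear []       []       (suc b) [] = zero-linear
    rowF-linear (x ∷ xs) (i ∷ is) b (c ∷ cs) =
      mixture-linear (∑-linear (0 ∷ 1 ∷ [])) λ a →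
      mixture-linear (∑-linear (upTo (suc (suc b)))) λ d →
      scale-linear (wF q s x i a b c d) (precompose-linear (a ∷_) (rowF-linear xs is d cs))

    rowC-linear : ∀ {p} y e B (Cs : Vec ℕ p) → Linear (rowC q s y e B Cs)
    rowC-linear y e zero    [] = evaluation-linear []
    rowC-linear y e (suc B) [] = zero-linear
    rowC-linear y e B (C ∷ Cs) =
      mixture-linear (∑-linear (upTo (suc (suc C)))) λ A →
      mixture-linear (∑-linear (0 ∷ 1 ∷ [])) λ D →
      scale-linear (wC q s y e A B C D) (precompose-linear (A ∷_) (rowC-linear y e D Cs))

    linear-rowC-comm : ∀ {X : Set} {Λ : (X → Carrier) → Carrier} → Linear Λ →
      ∀ {p} y e B (Cs : Vec ℕ p) (G : Vec ℕ p → X → Carrier) →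
      Λ (λ a → rowC q s y e B Cs (λ As → G As a)) ≈ rowC q s y e B Cs (λ As → Λ (G As))
    linear-rowC-comm lin y e zero    [] G = refl
    linear-rowC-comm lin y e (suc B) [] G = Linear.0-homo lin
    linear-rowC-comm {X} lin y e B (C ∷ Cs) G =
      trans (∑-homo LC (λ A a → ∑ L01 (λ D → term A D a))) (∑-cong LC λ A →
      trans (∑-homo L01 (term A)) (∑-cong L01 λ D →
      trans (*-homo (wC q s y e A B C D) (λ a → rowC q s y e D Cs (λ As → G (A ∷ As) a)))
            (*-congˡ (linear-rowC-comm lin y e D Cs (G ∘ (A ∷_))))))
      where
      open Linear lin

      LC L01 : List ℕ
      LC  = upTo (suc (suc C))
      L01 = 0 ∷ 1 ∷ []

      term : ℕ → ℕ → X → Carrier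
      term A D a = wC q s y e A B C D * rowC q s y e D Cs (λ As → G (A ∷ As) a)

    gridF-no-columns : ∀ {p} (ms : Vec ℕ p) → gridF q s [] [] (toList ms) [] ≈ allZero ms
    gridF-no-columns []           = refl
    gridF-no-columns (zero ∷ ms)  = gridF-no-columns ms
    gridF-no-columns (suc m ∷ ms) = refl

    module Column (x y i e : Carrier) (xy≈1 : x * y ≈ 1#) (e≈xi : e ≈ x * i) where

      gauge : ℕ → Carrier
      gauge zero    = 1#
      gauge (suc _) = y

      *[xy] : ∀ t → t * (x * y) ≈ t
      *[xy] t = trans (*-congˡ xy≈1) (*-identityʳ t)

      -- After writing e = x i, each vertex identity is one between the numerators of the weights.
      weight-match : ∀ {β β′ u v g g′} → β ≡ β′ → u * g ≈ g′ * (v * x) →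
                     (if β then u * i else 0#) * g ≈ g′ * (if β′ then v * e else 0#)
      weight-match {false} {g = g} {g′} ≡-refl _ = trans (zeroˡ g) (sym (zeroʳ g′))
      weight-match {true} {u = u} {v} {g} {g′} ≡-refl ug≈g′vx = begin
        u * i * g           ≈⟨ solve 3 (λ u i g → u :* i :* g := u :* g :* i) refl u i g ⟩
        u * g * i           ≈⟨ *-congʳ ug≈g′vx ⟩
        g′ * (v * x) * i    ≈⟨ solve 4 (λ g′ v x i → g′ :* (v :* x) :* i := g′ :* (v :* (x :* i)))
                                 refl g′ v x i ⟩
        g′ * (v * (x * i))  ≈⟨ *-congˡ (*-congˡ (sym e≈xi)) ⟩
        g′ * (v * e)        ∎

      numerator₀₀ : ∀ Q → (x - Q * s) * 1# ≈ 1# * ((1# - s * y * Q) * x)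
      numerator₀₀ Q = begin
        (x - Q * s) * 1#               ≈⟨ *-identityʳ _ ⟩
        x - Q * s                      ≈⟨ //-cong₂ (sym (*-identityˡ x)) (sym syQx≈Qs) ⟩
        1# * x - s * y * Q * x         ≈⟨ sym ([y-z]x≈yx-zx x 1# (s * y * Q)) ⟩
        (1# - s * y * Q) * x           ≈⟨ sym (*-identityˡ _) ⟩
        1# * ((1# - s * y * Q) * x)    ∎
        where
        syQx≈Qs : s * y * Q * x ≈ Q * s
        syQx≈Qs = trans (solve 4 (λ s y Q x → s :* y :* Q :* x := Q :* s :* (x :* y)) refl s y Q x)
                        (*[xy] (Q * s))

      numerator₀₁ : ∀ Q → (1# - Q) * 1# ≈ y * ((1# - Q) * x)
      numerator₀₁ Q = begin
        (1# - Q) * 1#          ≈⟨ *-identityʳ _ ⟩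
        1# - Q                 ≈⟨ sym (*[xy] _) ⟩
        (1# - Q) * (x * y)     ≈⟨ solve 3 (λ t x y → t :* (x :* y) := y :* (t :* x)) refl _ x y ⟩
        y * ((1# - Q) * x)     ∎

      numerator₁₀ : ∀ Q → (1# - Q * s * s) * x * y ≈ 1# * ((1# - s * s * Q) * y * x)
      numerator₁₀ Q = begin
        (1# - Q * s * s) * x * y          ≈⟨ *-congʳ (*-congʳ (//-cong₂ refl
                                               (solve 2 (λ Q s → Q :* s :* s := s :* s :* Q) refl Q s))) ⟩
        (1# - s * s * Q) * x * y          ≈⟨ solve 3 (λ t x y → t :* x :* y := con 1 :* (t :* y :* x))
                                               refl _ x y ⟩
        1# * ((1# - s * s * Q) * y * x)   ∎

      numerator₁₁ : ∀ Q → (1# - Q * x * s) * y ≈ y * ((y - s * Q) * x)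
      numerator₁₁ Q = begin
        (1# - Q * x * s) * y          ≈⟨ [y-z]x≈yx-zx y 1# (Q * x * s) ⟩
        1# * y - Q * x * s * y        ≈⟨ //-cong₂ (*-identityˡ y) Qxsy≈sQ ⟩
        y - s * Q                     ≈⟨ sym (*[xy] _) ⟩
        (y - s * Q) * (x * y)         ≈⟨ solve 3 (λ t x y → t :* (x :* y) := y :* (t :* x)) refl _ x y ⟩
        y * ((y - s * Q) * x)         ∎
        where
        Qxsy≈sQ : Q * x * s * y ≈ s * Q
        Qxsy≈sQ = trans (solve 4 (λ Q x s y → Q :* x :* s :* y := s :* Q :* (x :* y)) refl Q x s y)
                        (*[xy] (s * Q))

      weight-transpose : ∀ a b c d → wF q s x i a b c d * gauge a ≈ gauge c * wC q s y e d c b a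
      weight-transpose 0 b 0 d = weight-match (≡ᵇ-comm b d) (numerator₀₀ (pow q b))
      weight-transpose 0 b 1 d = weight-match ≡-refl (numerator₀₁ (pow q b))
      weight-transpose 1 b 0 d = weight-match (≡ᵇ-comm (suc b) d) (numerator₁₀ (pow q b))
      weight-transpose 1 b 1 d = weight-match (≡ᵇ-comm b d) (numerator₁₁ (pow q b))
      weight-transpose 0 b (suc (suc c)) d = trans (zeroˡ 1#) (sym (zeroʳ y))
      weight-transpose 1 b (suc (suc c)) d = trans (zeroˡ y) (sym (zeroʳ y))
      weight-transpose (suc (suc a)) b 0 d = trans (zeroˡ y) (sym (zeroʳ 1#))
      weight-transpose (suc (suc a)) b 1 d = trans (zeroˡ y) (sym (zeroʳ y))
      weight-transpose (suc (suc a)) b (suc (suc c)) d = trans (zeroˡ y) (sym (zeroʳ y))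

      gridF-first-column : ∀ {p k} (ms : Vec ℕ p) c (xs is : Vec Carrier k) (cs : Vec ℕ k) →
        gridF q s (x ∷ xs) (i ∷ is) (toList ms) (c ∷ cs)
          ≈ gauge c * rowC q s y e c ms (λ ms′ → gridF q s xs is (toList ms′) cs)
      gridF-first-column []       zero    xs is cs = sym (*-identityˡ _)
      gridF-first-column []       (suc c) xs is cs = sym (zeroʳ y)
      gridF-first-column {k = k} (m ∷ ms) c xs is cs = begin
          ∑ L01 (λ a → ∑ Lm (λ d → wF q s x i a m c d
                                   * rowF q s xs is d cs (λ as → rest (a ∷ as))))
        ≈⟨ ∑-cong L01 (λ a → ∑-cong Lm (λ d → vertex a d)) ⟩
          ∑ L01 (λ a → ∑ Lm (λ d → gauge c * U a d))
        ≈⟨ ∑-cong L01 (λ a → Linear.*-homo (∑-linear Lm) (gauge c) (U a)) ⟩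
          ∑ L01 (λ a → gauge c * ∑ Lm (U a))
        ≈⟨ Linear.*-homo (∑-linear L01) (gauge c) (λ a → ∑ Lm (U a)) ⟩
          gauge c * ∑ L01 (λ a → ∑ Lm (U a))
        ≈⟨ *-congˡ (Linear.∑-homo (∑-linear L01) Lm (λ d a → U a d)) ⟩
          gauge c * ∑ Lm (λ d → ∑ L01 (λ a → U a d))
        ∎
        where
        L01 Lm : List ℕ
        L01 = 0 ∷ 1 ∷ []
        Lm  = upTo (suc (suc m))

        rest : Vec ℕ (suc k) → Carrier
        rest = gridF q s (x ∷ xs) (i ∷ is) (toList ms)

        peeled : ℕ → Vec ℕ k → Carrier
        peeled a as = rowC q s y e a ms (λ ms′ → gridF q s xs is (toList ms′) as)

        T : ℕ → ℕ → Carrier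
        T a d = rowC q s y e a ms (λ ms′ → gridF q s xs is (toList (d ∷ ms′)) cs)

        column : ∀ a d → rowF q s xs is d cs (λ as → rest (a ∷ as)) ≈ gauge a * T a d
        column a d = begin
          rowF q s xs is d cs (λ as → rest (a ∷ as))
            ≈⟨ cong (λ as → gridF-first-column ms a xs is as) ⟩
          rowF q s xs is d cs (λ as → gauge a * peeled a as)
            ≈⟨ *-homo (gauge a) (peeled a) ⟩
          gauge a * rowF q s xs is d cs (peeled a)
            ≈⟨ *-congˡ (linear-rowC-comm (rowF-linear xs is d cs) y e a ms (gridF q s xs is ∘ toList)) ⟩
          gauge a * T a d
            ∎
          where open Linear (rowF-linear xs is d cs)

        U : ℕ → ℕ → Carrier
        U a d = wC q s y e d c m a * T a d

        vertex : ∀ a d → wF q s x i a m c d * rowF q s xs is d cs (λ as → rest (a ∷ as)) ≈ gauge c * U a d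
        vertex a d = begin
          wF q s x i a m c d * rowF q s xs is d cs (λ as → rest (a ∷ as))
            ≈⟨ *-congˡ (column a d) ⟩
          wF q s x i a m c d * (gauge a * T a d)
            ≈⟨ sym (*-assoc _ _ _) ⟩
          wF q s x i a m c d * gauge a * T a d
            ≈⟨ *-congʳ (weight-transpose a m c d) ⟩
          gauge c * wC q s y e d c m a * T a d
            ≈⟨ *-assoc _ _ _ ⟩
          gauge c * U a d
            ∎

    gridF-transpose : ∀ {p n} (x y i e : Vec Carrier n) →
      (∀ j → lookup x j * lookup y j ≈ 1#) → (∀ j → lookup e j ≈ lookup x j * lookup i j) →
      (ms : Vec ℕ p) → gridF q s x i (toList ms) (replicate n 1) ≈ prodV y * gridC q s y e ms
    gridF-transpose [] [] [] [] _ _ ms = trans (gridF-no-columns ms) (sym (*-identityˡ _))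
    gridF-transpose {n = suc n} (x ∷ xs) (y ∷ ys) (i ∷ is) (e ∷ es) xy≈1 e≈xi ms = begin
      gridF q s (x ∷ xs) (i ∷ is) (toList ms) (1 ∷ replicate n 1)
        ≈⟨ Column.gridF-first-column x y i e (xy≈1 Fin.zero) (e≈xi Fin.zero) ms 1 xs is _ ⟩
      y * rowC q s y e 1 ms (λ ms′ → gridF q s xs is (toList ms′) (replicate n 1))
        ≈⟨ *-congˡ (cong (λ ms′ → gridF-transpose xs ys is es (xy≈1 ∘ Fin.suc) (e≈xi ∘ Fin.suc) ms′)) ⟩
      y * rowC q s y e 1 ms (λ ms′ → prodV ys * gridC q s ys es ms′)
        ≈⟨ *-congˡ (*-homo (prodV ys) _) ⟩
      y * (prodV ys * rowC q s y e 1 ms (gridC q s ys es))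
        ≈⟨ sym (*-assoc y _ _) ⟩
      prodV (y ∷ ys) * gridC q s (y ∷ ys) (e ∷ es) ms
        ∎
      where open Linear (rowC-linear y e 1 ms)

mainTheorem3 : ∀ {c ℓ : Level} (R : CommutativeRing c ℓ) →
  let open CommutativeRing R
      open SixVertex R
  in (q s : Carrier) (P : ℕ) (m : Vec ℕ P) (n : ℕ) → sum m ≡ n →
     (x xinv d e : Vec Carrier n) →
     (∀ i → lookup x i * lookup xinv i ≈ 1#) →
     (∀ i → (lookup x i - s) * lookup d i ≈ 1#) →
     (∀ i → (1# - s * lookup xinv i) * lookup e i ≈ 1#) →
     Fm q s m x d ≈ prodV xinv * Fcal q s m xinv e
mainTheorem3 R q s P m n _ x xinv d e x*xinv≈1 [x-s]d≈1 [1-s*xinv]e≈1 =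
  gridF-transpose x xinv d e x*xinv≈1
    (λ j → inverse-1-sy s (x*xinv≈1 j) ([x-s]d≈1 j) ([1-s*xinv]e≈1 j)) m
  where
  open Transposition R
  open Lattice q s
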